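{- For all integers $i\neq j$ with $|i-j|<5$, $\gcd(S_i,S_j)=1$ and $\gcd(T_i,T_j)=1$, where $(S_n)$ and $(T_n)$ are the sequences described in the context.
   Context: $(S_n)_{n\in\mathbb{Z}}$ is the sequence with $S_{ -2}=S_{ -1}=S_0=S_1=S_2=1$ satisfying $S_{n+5}S_n=S_{n+4}S_{n+1}+S_{n+3}S_{n+2}$ for all $n\in\mathbb{Z}$; it consists of positive integers. $(T_n)_{n\in\mathbb{Z}}$ is defined by $T_1=1,T_2=-1,T_3=1,T_4=1,T_5=-7$, $T_{n+5}T_n=T_{n+4}T_{n+1}+T_{n+3}T_{n+2}$ for $n\geq1$, $T_0=0$ and $T_{ -n}=-T_n$; it is an integer sequence satisfying the same recurrence for all $n\in\mathbb{Z}$. -}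

module Defs where

open import Data.Nat using (ℕ; zero; suc) renaming (_+_ to _+ℕ_)
open import Data.Integer using (ℤ; +_; -[1+_]; _+_; _*_; -_; 0ℤ; 1ℤ)
open import Data.Integer.DivMod using (_/_)

-- Integer division by a possibly-zero divisor (dividing by 0 returns 0).
-- In the sequences below all divisions are exact and by nonzero numbers
-- (as asserted in the context), so this convention is never exercised.
_÷_ : ℤ → ℤ → ℤ
a ÷ (+ zero)    = 0ℤ
a ÷ (+ suc n)   = a / (+ suc n)
a ÷ (-[1+ n ])  = a / -[1+ n ]

-- five consecutive terms (x_n, x_{n+1}, x_{n+2}, x_{n+3}, x_{n+4})
record Window : Set where
  constructor ⟨_,_,_,_,_⟩
  field
    w0 w1 w2 w3 w4 : ℤ
open Window public

stepF : Window → Window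
stepF ⟨ a , b , c , d , e ⟩ = ⟨ b , c , d , e , (e * b + d * c) ÷ a ⟩

stepB : Window → Window
stepB ⟨ a , b , c , d , e ⟩ = ⟨ (d * a + c * b) ÷ e , a , b , c , d ⟩

iter : (Window → Window) → ℕ → Window → Window
iter f zero    w = w
iter f (suc k) w = f (iter f k w)

-- window (S_{-2}, S_{-1}, S_0, S_1, S_2)
initS : Window
initS = ⟨ 1ℤ , 1ℤ , 1ℤ , 1ℤ , 1ℤ ⟩

-- iter stepF k initS = (S_{k-2}, ..., S_{k+2});
-- iter stepB k initS = (S_{-2-k}, ..., S_{2-k})
S : ℤ → ℤ
S (+ n)     = w0 (iter stepF (n +ℕ 2) initS)
S -[1+ n ]  = w4 (iter stepB (n +ℕ 3) initS)

-- window (T_1, ..., T_5)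
initT : Window
initT = ⟨ 1ℤ , - 1ℤ , 1ℤ , 1ℤ , - (+ 7) ⟩

T : ℤ → ℤ
T (+ zero)    = 0ℤ
T (+ suc n)   = w0 (iter stepF n initT)
T -[1+ n ]    = - w0 (iter stepF n initT)

-- Simultaneous induction shows that every division in the recurrence is exact and
-- that any five consecutive terms are pairwise coprime. Coprimality propagates
-- through x_{n+5} x_n = x_{n+4} x_{n+1} + x_{n+3} x_{n+2}: a common divisor of x_{n+5}
-- and one factor on the right divides the other product, to whose factors it is
-- coprime. For exactness, the five previous relations and a polynomial identity
-- show that x_{n+5} divides x_{n+1} x_{n+2} x_{n+3} x_{n+4} (x_{n+9} x_{n+6} + x_{n+8} x_{n+7}),
-- and the four coprime factors cancel. Negative indices reduce to positive ones
-- because S is even and T is odd; a pair straddling 0 always contains a unit.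

module Submission where

open import Defs
open import Data.Nat using (_<_)
open import Data.Integer using (ℤ; _-_; ∣_∣; 1ℤ)
open import Data.Integer.GCD using (gcd)
open import Relation.Binary.PropositionalEquality using (_≡_; _≢_)
open import Data.Product using (_×_)

open import Data.Nat as ℕ using (ℕ; zero; suc; s≤s)
import Data.Nat.Properties as ℕ
import Data.Nat.Divisibility as ℕ
import Data.Nat.Coprimality as ℕ
open import Data.Integer using (_+_; _*_; -_; +_; -[1+_]; 0ℤ; NonZero)
open import Data.Integer.Properties
  using ( abs-*; *-comm; +-comm; +-identityˡ; +-inverseʳ; neg-involutive
        ; ∣-i∣≡∣i∣; ∣i∣≡0⇒i≡0; i-j≡0⇒i≡j; [1+m]⊖[1+n]≡m⊖n)
open import Data.Integer.Divisibility using (_∣_)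
import Data.Integer.Divisibility.Signed as Signed
open import Data.Integer.DivMod using (_/_; _%_; a≡a%n+[a/n]*n)
open import Data.Integer.Coprimality using (Coprime; coprime?; coprime-divisor)
  renaming (sym to coprime-sym)
open import Data.Integer.Tactic.RingSolver using (solve-∀)
open import Data.List using (List; []; _∷_)
open import Data.List.Relation.Unary.All using (All; []; _∷_)
open import Data.List.Relation.Unary.AllPairs using (AllPairs; []; _∷_; head; allPairs?)
open import Data.Product using (_,_; ∃-syntax)
open import Data.Sum using (_⊎_; inj₁; inj₂)
open import Data.Empty using (⊥-elim)
open import Relation.Nullary.Decidable using (from-yes)
open import Relation.Binary.PropositionalEquality
  using (refl; sym; trans; cong; cong₂; subst; subst₂; module ≡-Reasoning)
open ≡-Reasoning

∣⇒%≡0 : ∀ a d .{{_ : NonZero d}} → d ∣ a → a % d ≡ 0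
∣⇒%≡0 (+ n)    d d∣a = ℕ.n∣m⇒m%n≡0 n ∣ d ∣ d∣a
∣⇒%≡0 -[1+ n ] d d∣a rewrite ℕ.n∣m⇒m%n≡0 (suc n) ∣ d ∣ d∣a = refl

∣⇒[a/d]*d≡a : ∀ a d .{{_ : NonZero d}} → d ∣ a → (a / d) * d ≡ a
∣⇒[a/d]*d≡a a d d∣a = begin
  (a / d) * d              ≡⟨ sym (+-identityˡ _) ⟩
  + 0 + (a / d) * d        ≡⟨ cong (λ r → + r + (a / d) * d) (∣⇒%≡0 a d d∣a) ⟨
  + (a % d) + (a / d) * d  ≡⟨ a≡a%n+[a/n]*n a d ⟨
  a                        ∎

∣⇒[a÷d]*d≡a : ∀ a d → d ∣ a → (a ÷ d) * d ≡ a
∣⇒[a÷d]*d≡a a (+ zero)    0∣a = sym (∣i∣≡0⇒i≡0 (ℕ.0∣⇒≡0 0∣a))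
∣⇒[a÷d]*d≡a a d@(+ suc _) d∣a = ∣⇒[a/d]*d≡a a d d∣a
∣⇒[a÷d]*d≡a a d@(-[1+ _ ]) d∣a = ∣⇒[a/d]*d≡a a d d∣a

m∣m*n : ∀ m n → m ∣ m * n
m∣m*n m n = Signed.∣⇒∣ᵤ (Signed.∣m⇒∣m*n n (Signed.∣-refl {m}))

coprime⇒gcd≡1 : ∀ i j → Coprime i j → gcd i j ≡ 1ℤ
coprime⇒gcd≡1 i j c = cong +_ (ℕ.coprime⇒gcd≡1 c)

∣i∣≡1⇒coprime : ∀ i j → ∣ i ∣ ≡ 1 → Coprime i j
∣i∣≡1⇒coprime i j ∣i∣≡1 = subst (λ m → ℕ.Coprime m ∣ j ∣) (sym ∣i∣≡1) (ℕ.1-coprimeTo ∣ j ∣)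

coprime-of-sum : ∀ z m p t c d → z * m ≡ p * t + c * d →
                 Coprime p c → Coprime p d → Coprime p z
coprime-of-sum z m p t c d eq p⊥c p⊥d {k} (k∣p , k∣z) = p⊥d (k∣p , k∣d)
  where
  k∣p*t+c*d : + k Signed.∣ p * t + c * d
  k∣p*t+c*d = subst (+ k Signed.∣_) eq (Signed.∣m⇒∣m*n m (Signed.∣ᵤ⇒∣ {+ k} {z} k∣z))
  k∣c*d : + k Signed.∣ c * d
  k∣c*d = Signed.∣m+n∣m⇒∣n k∣p*t+c*d (Signed.∣m⇒∣m*n t (Signed.∣ᵤ⇒∣ {+ k} {p} k∣p))
  k⊥c : ℕ.Coprime k ∣ c ∣
  k⊥c (e∣k , e∣c) = p⊥c (ℕ.∣-trans e∣k k∣p , e∣c)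
  k∣d : k ℕ.∣ ∣ d ∣
  k∣d = ℕ.coprime-divisor k⊥c (subst (k ℕ.∣_) (abs-* c d) (Signed.∣⇒∣ᵤ k∣c*d))

somos5-combination : ∀ x0 x1 x2 x3 x4 x5 x6 x7 x8 x9 →
  x1 * (x2 * (x3 * (x4 * (x9 * x6 + x8 * x7)))) ≡
    x5 * (x1 * x2 * (x3 * x6 * x8 + x4 * x6 * x7) + x1 * x7 * (x4 * x4 * x4)
          + x3 * x6 * x7 * (x2 * x2 + x4 * x0))
    + - (x3 * x4 * x6 * x7) * (x5 * x0 - (x4 * x1 + x3 * x2))
    + x2 * x3 * x6 * x7 * (x6 * x1 - (x5 * x2 + x4 * x3))
    + x1 * x4 * x4 * x7 * (x7 * x2 - (x6 * x3 + x5 * x4))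
    + x1 * x2 * x4 * x7 * (x8 * x3 - (x7 * x4 + x6 * x5))
    + x1 * x2 * x3 * x6 * (x9 * x4 - (x8 * x5 + x7 * x6))
somos5-combination = solve-∀

combination-of-zeros : ∀ a c₀ c₁ c₂ c₃ c₄ {r₀ r₁ r₂ r₃ r₄} →
  r₀ ≡ 0ℤ → r₁ ≡ 0ℤ → r₂ ≡ 0ℤ → r₃ ≡ 0ℤ → r₄ ≡ 0ℤ →
  a + c₀ * r₀ + c₁ * r₁ + c₂ * r₂ + c₃ * r₃ + c₄ * r₄ ≡ a
combination-of-zeros a c₀ c₁ c₂ c₃ c₄ refl refl refl refl refl = zeros a c₀ c₁ c₂ c₃ c₄
  where
  zeros : ∀ a c₀ c₁ c₂ c₃ c₄ → a + c₀ * 0ℤ + c₁ * 0ℤ + c₂ * 0ℤ + c₃ * 0ℤ + c₄ * 0ℤ ≡ a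
  zeros = solve-∀

i≡j⇒i-j≡0 : ∀ {i j} → i ≡ j → i - j ≡ 0ℤ
i≡j⇒i-j≡0 {i} refl = +-inverseʳ i

somos5-divides : ∀ x0 x1 x2 x3 x4 x5 x6 x7 x8 x9 →
  x5 * x0 ≡ x4 * x1 + x3 * x2 →
  x6 * x1 ≡ x5 * x2 + x4 * x3 →
  x7 * x2 ≡ x6 * x3 + x5 * x4 →
  x8 * x3 ≡ x7 * x4 + x6 * x5 →
  x9 * x4 ≡ x8 * x5 + x7 * x6 →
  Coprime x5 x1 → Coprime x5 x2 → Coprime x5 x3 → Coprime x5 x4 →
  x5 ∣ x9 * x6 + x8 * x7
somos5-divides x0 x1 x2 x3 x4 x5 x6 x7 x8 x9 e₀ e₁ e₂ e₃ e₄ c₁ c₂ c₃ c₄ =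
  coprime-divisor x5 x4 _ c₄ (coprime-divisor x5 x3 _ c₃
    (coprime-divisor x5 x2 _ c₂ (coprime-divisor x5 x1 _ c₁ x5∣product)))
  where
  q = x1 * x2 * (x3 * x6 * x8 + x4 * x6 * x7) + x1 * x7 * (x4 * x4 * x4)
      + x3 * x6 * x7 * (x2 * x2 + x4 * x0)
  product≡x5*q : x1 * (x2 * (x3 * (x4 * (x9 * x6 + x8 * x7)))) ≡ x5 * q
  product≡x5*q = trans (somos5-combination x0 x1 x2 x3 x4 x5 x6 x7 x8 x9)
    (combination-of-zeros (x5 * q) (- (x3 * x4 * x6 * x7)) (x2 * x3 * x6 * x7)
      (x1 * x4 * x4 * x7) (x1 * x2 * x4 * x7) (x1 * x2 * x3 * x6)
      (i≡j⇒i-j≡0 e₀) (i≡j⇒i-j≡0 e₁) (i≡j⇒i-j≡0 e₂) (i≡j⇒i-j≡0 e₃) (i≡j⇒i-j≡0 e₄))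
  x5∣product : x5 ∣ x1 * (x2 * (x3 * (x4 * (x9 * x6 + x8 * x7))))
  x5∣product = subst (x5 ∣_) (sym product≡x5*q) (m∣m*n x5 q)

toList : Window → List ℤ
toList ⟨ a , b , c , d , e ⟩ = a ∷ b ∷ c ∷ d ∷ e ∷ []

PairwiseCoprime : Window → Set
PairwiseCoprime W = AllPairs Coprime (toList W)

-- The recurrence at a window; it fails when the truncating division in stepF is inexact.
StepExact : Window → Set
StepExact W = w4 (stepF W) * w0 W ≡ w4 W * w1 W + w3 W * w2 W

stepF-pairwiseCoprime : ∀ W → StepExact W → PairwiseCoprime W → PairwiseCoprime (stepF W)
stepF-pairwiseCoprime ⟨ x0 , x1 , x2 , x3 , x4 ⟩ e
  (_ ∷ (c12 ∷ c13 ∷ c14 ∷ []) ∷ (c23 ∷ c24 ∷ []) ∷ (c34 ∷ []) ∷ [] ∷ []) =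
  (c12 ∷ c13 ∷ c14 ∷ c15 ∷ []) ∷ (c23 ∷ c24 ∷ c25 ∷ []) ∷ (c34 ∷ c35 ∷ []) ∷ (c45 ∷ []) ∷ [] ∷ []
  where
  x5 = w4 (stepF ⟨ x0 , x1 , x2 , x3 , x4 ⟩)
  e₃ : x5 * x0 ≡ x3 * x2 + x4 * x1
  e₃ = trans e (+-comm (x4 * x1) (x3 * x2))
  c45 : Coprime x4 x5
  c45 = coprime-of-sum x5 x0 x4 x1 x3 x2 e
          (coprime-sym {x3} {x4} c34) (coprime-sym {x2} {x4} c24)
  c15 : Coprime x1 x5
  c15 = coprime-of-sum x5 x0 x1 x4 x3 x2 (trans e (cong (_+ x3 * x2) (*-comm x4 x1))) c13 c12
  c35 : Coprime x3 x5
  c35 = coprime-of-sum x5 x0 x3 x2 x4 x1 e₃ c34 (coprime-sym {x1} {x3} c13)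
  c25 : Coprime x2 x5
  c25 = coprime-of-sum x5 x0 x2 x3 x4 x1 (trans e₃ (cong (_+ x4 * x1) (*-comm x3 x2)))
          c24 (coprime-sym {x1} {x2} c12)

stepF⁵-exact : ∀ W → StepExact W → StepExact (iter stepF 1 W) → StepExact (iter stepF 2 W) →
  StepExact (iter stepF 3 W) → StepExact (iter stepF 4 W) → PairwiseCoprime (stepF W) →
  StepExact (iter stepF 5 W)
stepF⁵-exact W e₀ e₁ e₂ e₃ e₄
  ((_ ∷ _ ∷ _ ∷ c15 ∷ []) ∷ (_ ∷ _ ∷ c25 ∷ []) ∷ (_ ∷ c35 ∷ []) ∷ (c45 ∷ []) ∷ [] ∷ []) =
  ∣⇒[a÷d]*d≡a (x 9 * x 6 + x 8 * x 7) (x 5)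
    (somos5-divides (x 0) (x 1) (x 2) (x 3) (x 4) (x 5) (x 6) (x 7) (x 8) (x 9) e₀ e₁ e₂ e₃ e₄
      (coprime-sym {x 1} {x 5} c15) (coprime-sym {x 2} {x 5} c25)
      (coprime-sym {x 3} {x 5} c35) (coprime-sym {x 4} {x 5} c45))
  where
  x : ℕ → ℤ
  x k = w0 (iter stepF k W)

module Somos5 (w : Window) (coprime₀ : PairwiseCoprime w)
  (exact₀ : StepExact w) (exact₁ : StepExact (iter stepF 1 w)) (exact₂ : StepExact (iter stepF 2 w))
  (exact₃ : StepExact (iter stepF 3 w)) (exact₄ : StepExact (iter stepF 4 w))
  where

  window : ℕ → Window
  window k = iter stepF k w

  x : ℕ → ℤ
  x k = w0 (window k)

  window-exact : ∀ k → StepExact (window k)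
  window-pairwiseCoprime : ∀ k → PairwiseCoprime (window k)

  window-exact 0 = exact₀
  window-exact 1 = exact₁
  window-exact 2 = exact₂
  window-exact 3 = exact₃
  window-exact 4 = exact₄
  window-exact (suc (suc (suc (suc (suc k))))) =
    stepF⁵-exact (window k) (window-exact k) (window-exact (suc k)) (window-exact (suc (suc k)))
      (window-exact (suc (suc (suc k)))) (window-exact (suc (suc (suc (suc k)))))
      (window-pairwiseCoprime (suc k))

  window-pairwiseCoprime zero    = coprime₀
  window-pairwiseCoprime (suc k) =
    stepF-pairwiseCoprime (window k) (window-exact k) (window-pairwiseCoprime k)

  coprime-ahead : ∀ n d → d < 4 → Coprime (x n) (x (suc d ℕ.+ n))
  coprime-ahead n d d<4 = ahead d d<4 (head (window-pairwiseCoprime n))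
    where
    ahead : ∀ d → d < 4 →
      All (Coprime (x n)) (x (1 ℕ.+ n) ∷ x (2 ℕ.+ n) ∷ x (3 ℕ.+ n) ∷ x (4 ℕ.+ n) ∷ []) →
      Coprime (x n) (x (suc d ℕ.+ n))
    ahead 0 _ (c ∷ _)             = c
    ahead 1 _ (_ ∷ c ∷ _)         = c
    ahead 2 _ (_ ∷ _ ∷ c ∷ _)     = c
    ahead 3 _ (_ ∷ _ ∷ _ ∷ c ∷ _) = c
    ahead (suc (suc (suc (suc _)))) (s≤s (s≤s (s≤s (s≤s ())))) _

close-indices : ∀ i j → i ≢ j → ∣ i - j ∣ < 5 →
  ∃[ d ] d < 4 × (i ≡ j + + suc d ⊎ j ≡ i + + suc d)
close-indices i j i≢j ∣i-j∣<5 with i - j in eq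
... | + zero    = ⊥-elim (i≢j (i-j≡0⇒i≡j i j eq))
... | + suc d   = d , ℕ.≤-pred ∣i-j∣<5 , inj₁ (trans (i≡j+[i-j] i j) (cong (λ k → j + k) eq))
  where
  i≡j+[i-j] : ∀ i j → i ≡ j + (i - j)
  i≡j+[i-j] = solve-∀
... | -[1+ d ] = d , ℕ.≤-pred ∣i-j∣<5 , inj₂ (trans (j≡i-[i-j] i j) (cong (λ k → i + - k) eq))
  where
  j≡i-[i-j] : ∀ i j → j ≡ i + - (i - j)
  j≡i-[i-j] = solve-∀

-[1+a]+[1+d]-cases : ∀ a d →
  (∃[ c ] a ≡ suc d ℕ.+ c × -[1+ a ] + + suc d ≡ -[1+ c ]) ⊎
  (∃[ c ] d ≡ a ℕ.+ c × -[1+ a ] + + suc d ≡ + c)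
-[1+a]+[1+d]-cases zero    d       = inj₂ (d , refl , refl)
-[1+a]+[1+d]-cases (suc a) zero    = inj₁ (a , refl , refl)
-[1+a]+[1+d]-cases (suc a) (suc d) with -[1+a]+[1+d]-cases a d
... | inj₁ (c , refl , eq) = inj₁ (c , refl , trans ([1+m]⊖[1+n]≡m⊖n (suc d) (suc a)) eq)
... | inj₂ (c , refl , eq) = inj₂ (c , refl , trans ([1+m]⊖[1+n]≡m⊖n (suc d) (suc a)) eq)

module _ (F : ℤ → ℤ) (∣F∣-even : ∀ i → ∣ F (- i) ∣ ≡ ∣ F i ∣)
  (∣F1∣≡1 : ∣ F 1ℤ ∣ ≡ 1) (∣F2∣≡1 : ∣ F (+ 2) ∣ ≡ 1)
  (coprime-ahead : ∀ n d → d < 4 → Coprime (F (+ n)) (F (+ (suc d ℕ.+ n))))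
  where

  coprime-across-zero : ∀ a c → a ℕ.+ suc c < 4 → Coprime (F -[1+ a ]) (F (+ suc c))
  coprime-across-zero 0 c _ = ∣i∣≡1⇒coprime (F -[1+ 0 ]) (F (+ suc c)) (trans (∣F∣-even 1ℤ) ∣F1∣≡1)
  coprime-across-zero 1 c _ = ∣i∣≡1⇒coprime (F -[1+ 1 ]) (F (+ suc c)) (trans (∣F∣-even (+ 2)) ∣F2∣≡1)
  coprime-across-zero (suc (suc a)) 0 _ =
    coprime-sym {F 1ℤ} {F -[1+ suc (suc a) ]} (∣i∣≡1⇒coprime (F 1ℤ) (F -[1+ suc (suc a) ]) ∣F1∣≡1)
  coprime-across-zero (suc (suc a)) (suc c) (s≤s (s≤s (s≤s a+2+c≤1)))
    with ℕ.m+n≤o⇒n≤o a a+2+c≤1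
  ... | s≤s ()

  coprime-at-distance : ∀ n d {m} → d < 4 → suc d ℕ.+ n ≡ m → Coprime (F (+ n)) (F (+ m))
  coprime-at-distance n d d<4 refl = coprime-ahead n d d<4

  coprime-mirror : ∀ i j → Coprime (F i) (F j) → Coprime (F (- i)) (F (- j))
  coprime-mirror i j = subst₂ ℕ.Coprime (sym (∣F∣-even i)) (sym (∣F∣-even j))

  coprime-shift : ∀ j d → d < 4 → Coprime (F j) (F (j + + suc d))
  coprime-shift (+ n) d d<4 = coprime-at-distance n d d<4 (ℕ.+-comm (suc d) n)
  coprime-shift -[1+ a ] d d<4 with -[1+a]+[1+d]-cases a d
  ... | inj₁ (c , refl , eq) rewrite eq =
    coprime-mirror (+ suc a) (+ suc c) (coprime-sym {F (+ suc c)} {F (+ suc a)}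
      (coprime-at-distance (suc c) d d<4 (ℕ.+-suc (suc d) c)))
  ... | inj₂ (zero , refl , eq) rewrite eq | ℕ.+-identityʳ a =
    coprime-mirror (+ suc a) 0ℤ (coprime-sym {F 0ℤ} {F (+ suc a)}
      (coprime-at-distance 0 a d<4 (ℕ.+-identityʳ (suc a))))
  ... | inj₂ (suc c , refl , eq) rewrite eq = coprime-across-zero a c d<4

  coprime-near : ∀ i j → i ≢ j → ∣ i - j ∣ < 5 → Coprime (F i) (F j)
  coprime-near i j i≢j ∣i-j∣<5 with close-indices i j i≢j ∣i-j∣<5
  ... | d , d<4 , inj₁ refl = coprime-sym {F j} {F (j + + suc d)} (coprime-shift j d d<4)
  ... | d , d<4 , inj₂ refl = coprime-shift i d d<4

reverse : Window → Window
reverse ⟨ a , b , c , d , e ⟩ = ⟨ e , d , c , b , a ⟩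

stepB-reverse : ∀ W → stepB (reverse W) ≡ reverse (stepF W)
stepB-reverse ⟨ a , b , c , d , e ⟩ =
  cong (λ n → ⟨ n ÷ a , e , d , c , b ⟩) (cong₂ _+_ (*-comm b e) (*-comm c d))

iter-stepB-reverse : ∀ k W → iter stepB k (reverse W) ≡ reverse (iter stepF k W)
iter-stepB-reverse zero    W = refl
iter-stepB-reverse (suc k) W =
  trans (cong stepB (iter-stepB-reverse k W)) (stepB-reverse (iter stepF k W))

module S-sequence =
  Somos5 initS (from-yes (allPairs? coprime? (toList initS))) refl refl refl refl refl

-- initS is a palindrome, so S -[1+ n ] is read off a forward window.
S-even : ∀ i → S (- i) ≡ S i
S-even (+ zero)  = refl
S-even (+ suc n) = trans (cong w4 (iter-stepB-reverse (n ℕ.+ 3) initS))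
                         (cong S-sequence.x (ℕ.+-suc n 2))
S-even -[1+ n ]  = sym (S-even (+ suc n))

S-coprime-ahead : ∀ n d → d < 4 → Coprime (S (+ n)) (S (+ (suc d ℕ.+ n)))
S-coprime-ahead n d d<4 = subst (λ m → Coprime (S (+ n)) (S-sequence.x m))
  (sym (ℕ.+-assoc (suc d) n 2)) (S-sequence.coprime-ahead (n ℕ.+ 2) d d<4)

module T-sequence =
  Somos5 initT (from-yes (allPairs? coprime? (toList initT))) refl refl refl refl refl

T-odd : ∀ i → T (- i) ≡ - T i
T-odd (+ zero)  = refl
T-odd (+ suc n) = refl
T-odd -[1+ n ]  = sym (neg-involutive (T (+ suc n)))

T-coprime-ahead : ∀ n d → d < 4 → Coprime (T (+ n)) (T (+ (suc d ℕ.+ n)))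
T-coprime-ahead zero    0 _ = ℕ.gcd≡1⇒coprime refl
T-coprime-ahead zero    1 _ = ℕ.gcd≡1⇒coprime refl
T-coprime-ahead zero    2 _ = ℕ.gcd≡1⇒coprime refl
T-coprime-ahead zero    3 _ = ℕ.gcd≡1⇒coprime refl
T-coprime-ahead zero    (suc (suc (suc (suc _)))) (s≤s (s≤s (s≤s (s≤s ()))))
T-coprime-ahead (suc m) d d<4 = subst (λ k → Coprime (T-sequence.x m) (T-sequence.x k))
  (sym (ℕ.+-suc d m)) (T-sequence.coprime-ahead m d d<4)

lemma2p3 : (i j : ℤ) → i ≢ j → ∣ i - j ∣ < 5 →
    (gcd (S i) (S j) ≡ 1ℤ) × (gcd (T i) (T j) ≡ 1ℤ)
lemma2p3 i j i≢j ∣i-j∣<5 =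
  coprime⇒gcd≡1 (S i) (S j) (coprime-near S ∣S∣-even refl refl S-coprime-ahead i j i≢j ∣i-j∣<5) ,
  coprime⇒gcd≡1 (T i) (T j) (coprime-near T ∣T∣-even refl refl T-coprime-ahead i j i≢j ∣i-j∣<5)
  where
  ∣S∣-even : ∀ i → ∣ S (- i) ∣ ≡ ∣ S i ∣
  ∣S∣-even i = cong ∣_∣ (S-even i)
  ∣T∣-even : ∀ i → ∣ T (- i) ∣ ≡ ∣ T i ∣
  ∣T∣-even i = trans (cong ∣_∣ (T-odd i)) (∣-i∣≡∣i∣ (T i))
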